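{- Let $\mathcal{P}$ be a preference profile (ties and incomplete lists allowed), $\gamma\in\mathbb{N}$, $(V,E)$ its acceptability graph and $E_1=\{\{x,y\}\in E:\mathrm{rank}_x(y)+\mathrm{rank}_y(x)\le\gamma\}$. Let $M$ be a stable matching with egalitarian cost at most $\gamma$. Then at most $\gamma^3$ edges of $E_1$ are harmlessly blocked by some edge in $M$.
   Context: Agents $V$; agent $i$ has acceptable set $V_i\subseteq V\setminus\{i\}$ with a transitive complete relation $\succeq_i$ on $V_i$ ($\succ_i$ strict part). Acceptability graph: edge $\{x,y\}$ iff $x\in V_y$, $y\in V_x$. A matching is a set of disjoint edges, $M(x)$ the partner or $\bot$; an edge $\{x,y\}\notin M$ blocks $M$ if ($M(x)=\bot$ or $y\succ_xM(x)$) and ($M(y)=\bot$ or $x\succ_yM(y)$); stable = no blocking edge. $\mathrm{rank}_j(i)=|\{x:x\succ_j i\}|$, $\mathrm{rank}_i(\bot)=|V_i|$, egalitarian cost $\sum_i\mathrm{rank}_i(M(i))$. Two disjoint edges $e=\{u,v\}$, $e'=\{u',v'\}$ block each other due to the pair $\{u,u'\}$ ($u\in e,u'\in e'$) if $u'\succ_u v$ and $u\succ_{u'}v'$. An edge $\{u',v'\}$ is critical for its endpoint $u'$ if $|\{x\in V_{u'}\setminus\{v'\}: x\succeq_{u'}v'\}|>\gamma$, and harmless for $u'$ otherwise. Edge $e$ harmlessly blocks $e'$ (at $u'$) if $e$ and $e'$ block each other due to a pair $\{u,u'\}$ with $u\in e$, $u'\in e'$ and $e'$ is harmless for $u'$.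 -}

module Defs where

open import Data.Nat using (ℕ; zero; suc; _+_; _≤_; _<_)
open import Data.Bool using (Bool; true; false; if_then_else_; T; not; _∧_)
open import Data.Fin using (Fin; toℕ)
open import Data.Maybe using (Maybe; just; nothing)
open import Data.List using (List; allFin; map)
open import Data.Nat.ListAction using (sum)
open import Data.Unit using (⊤)
open import Data.Fin using (_≟_)
open import Relation.Nullary.Decidable using (⌊_⌋)
open import Data.Product using (Σ; ∃; ∃-syntax; _×_; _,_)
open import Data.Sum using (_⊎_)
open import Relation.Nullary using (¬_)
open import Relation.Binary.PropositionalEquality using (_≡_; _≢_)

count : {n : ℕ} → (Fin n → Bool) → ℕ
count {n} p = sum (map (λ x → if p x then 1 else 0) (allFin n))

-- A preference profile on the agents V = Fin n.
--   acc i x      : x ∈ V_i   (x is acceptable to i)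
--   wpref i x y  : x ⪰_i y   (only meaningful for x, y ∈ V_i)
record Profile (n : ℕ) : Set where
  field
    acc       : Fin n → Fin n → Bool
    wpref     : Fin n → Fin n → Fin n → Bool
    acc-irrefl : ∀ i → T (not (acc i i))
    complete  : ∀ i x y → T (acc i x) → T (acc i y) →
                T (wpref i x y) ⊎ T (wpref i y x)
    transitive : ∀ i x y z → T (acc i x) → T (acc i y) → T (acc i z) →
                 T (wpref i x y) → T (wpref i y z) → T (wpref i x z)

module _ {n : ℕ} (P : Profile n) where
  open Profile P

  spref : Fin n → Fin n → Fin n → Bool
  spref i x y = acc i x ∧ acc i y ∧ wpref i x y ∧ not (wpref i y x)

  Edge : Fin n → Fin n → Set
  Edge x y = T (acc y x) × T (acc x y)

  rank : Fin n → Fin n → ℕ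
  rank j i = count (λ x → spref j x i)

  rankM : Fin n → Maybe (Fin n) → ℕ
  rankM i (just j) = rank i j
  rankM i nothing  = count (acc i)

  record Matching : Set where
    field
      partner   : Fin n → Maybe (Fin n)
      symmetric : ∀ x y → partner x ≡ just y → partner y ≡ just x
      isEdge    : ∀ x y → partner x ≡ just y → Edge x y
  open Matching public

  egalitarianCost : Matching → ℕ
  egalitarianCost M = sum (map (λ i → rankM i (partner M i)) (allFin n))

  WantsOver : Fin n → Fin n → Maybe (Fin n) → Set
  WantsOver x y nothing  = ⊤
  WantsOver x y (just z) = T (spref x y z)

  BlockingEdge : Matching → Fin n → Fin n → Set
  BlockingEdge M x y = Edge x y × partner M x ≢ just y ×
                       WantsOver x y (partner M x) × WantsOver y x (partner M y)

  Stable : Matching → Set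
  Stable M = ∀ x y → ¬ BlockingEdge M x y

  Harmless : ℕ → Fin n → Fin n → Set
  Harmless γ u' v' =
    count (λ x → acc u' x ∧ not ⌊ x ≟ v' ⌋ ∧ wpref u' x v') ≤ γ

  Disjoint : Fin n → Fin n → Fin n → Fin n → Set
  Disjoint u v u' v' = u ≢ u' × u ≢ v' × v ≢ u' × v ≢ v'

  BlockEachOtherAt : Fin n → Fin n → Fin n → Fin n → Set
  BlockEachOtherAt u v u' v' =
    Disjoint u v u' v' × T (spref u u' v) × T (spref u' u v')

  HarmlesslyBlocks : ℕ → Fin n → Fin n → Fin n → Fin n → Set
  HarmlesslyBlocks γ a b c d =
      (BlockEachOtherAt a b c d × Harmless γ c d)
    ⊎ (BlockEachOtherAt a b d c × Harmless γ d c)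
    ⊎ (BlockEachOtherAt b a c d × Harmless γ c d)
    ⊎ (BlockEachOtherAt b a d c × Harmless γ d c)

  InE₁ : ℕ → Fin n → Fin n → Set
  InE₁ γ x y = Edge x y × rank x y + rank y x ≤ γ

  HarmlesslyBlockedByM : ℕ → Matching → Fin n → Fin n → Set
  HarmlesslyBlockedByM γ M c d =
    ∃[ a ] ∃[ b ] (partner M a ≡ just b × HarmlesslyBlocks γ a b c d)

-- Charge every edge {w,d} that an edge of M harmlessly blocks at w to a triple (u, w, d) with
-- u matched, w ≻_u M(u), u ≻_w d and {w,d} harmless for w.  For fixed u there are
-- rank_u(M(u)) choices of w.  For fixed u and w let d₀ be the ⪰_w-least admissible d: every
-- other admissible d, and also u (which is not admissible), is one of the at most γ agents
-- x ≠ d₀ with x ⪰_w d₀ counted by harmlessness of {w,d₀}; so there are at most γ choices of d.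
-- Summing over u, there are at most γ · (egalitarian cost) ≤ γ² triples.
module Submission where

open import Defs
open import Data.Nat using (ℕ; _≤_; _<_; _^_)
open import Data.Fin using (Fin; toℕ)
open import Data.Product using (_×_; _,_)
open import Data.List using (List; length)
open import Data.List.Relation.Unary.All using (All)
open import Data.List.Relation.Unary.Unique.Propositional using (Unique)

open import Algebra.Properties.CommutativeSemigroup using (interchange)
open import Data.Nat using (zero; suc; _+_; _*_; _≤ᵇ_; z≤n; s≤s; _<?_)
open import Data.Nat.Properties
  using (≤-refl; ≤-reflexive; ≤-trans; ≤-pred; +-suc; +-mono-≤; *-monoˡ-≤; *-monoʳ-≤;
         *-distribʳ-+; *-identityˡ; m≤m*n; ≤ᵇ⇒≤; ≤⇒≤ᵇ; <-asym; +-commutativeSemigroup;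
         module ≤-Reasoning)
open import Data.Nat.ListAction using (sum)
open import Data.Fin using (_≟_)
open import Data.Bool using (Bool; true; false; T; not; _∧_; _∨_; if_then_else_)
open import Data.Bool.Properties using (T-∧; T-∨)
open import Data.Maybe using (Maybe; just; nothing)
open import Data.List using ([]; _∷_; [_]; _++_; map; concatMap; allFin)
open import Data.List.Properties using (length-++)
open import Data.List.Membership.Propositional using (_∈_; lose)
open import Data.List.Membership.Propositional.Properties using (∈-concatMap⁺; ∈-allFin)
open import Data.List.Relation.Binary.Subset.Propositional using (_⊆_)
open import Data.List.Relation.Unary.Any using (here; there)
import Data.List.Relation.Unary.All as All
open import Data.List.Relation.Unary.AllPairs using ([]; _∷_)
open import Data.List.Relation.Unary.Unique.Propositional.Properties using (allFin⁺)
open import Data.Product using (∃-syntax; proj₁; proj₂)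
open import Data.Sum using (_⊎_; inj₁; inj₂; reduce)
open import Data.Empty using (⊥-elim)
open import Function using (Equivalence; _∘_)
open import Relation.Nullary using (¬_; yes; no)
open import Relation.Nullary.Decidable using (⌊_⌋; T?; toWitness; fromWitnessFalse)
open import Relation.Unary using (Decidable)
open import Relation.Binary using (DecidableEquality)
open import Relation.Binary.PropositionalEquality using (_≡_; _≢_; refl; sym; cong; subst; module ≡-Reasoning)

T-∧⁺ : ∀ {x y} → T x → T y → T (x ∧ y)
T-∧⁺ tx ty = Equivalence.from T-∧ (tx , ty)

indicator : Bool → ℕ
indicator b = if b then 1 else 0

indicator-mono : ∀ a b → (T a → T b) → indicator a ≤ indicator b
indicator-mono false b     _   = z≤n
indicator-mono true  true  _   = ≤-refl
indicator-mono true  false a⇒b = ⊥-elim (a⇒b _)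

indicator-< : ∀ a b → ¬ T a → T b → indicator a < indicator b
indicator-< false true  _  _ = ≤-refl
indicator-< true  _     ¬a _ = ⊥-elim (¬a _)

indicator-∨ : ∀ a b → indicator (a ∨ b) ≤ indicator a + indicator b
indicator-∨ true  b = s≤s z≤n
indicator-∨ false b = ≤-refl

module _ {A : Set} where

  -- Defs' count p is countIn p (allFin n) by definition.
  countIn : (A → Bool) → List A → ℕ
  countIn p xs = sum (map (λ x → indicator (p x)) xs)

  sum-map-mono : ∀ {f g : A → ℕ} → (∀ x → f x ≤ g x) → ∀ xs → sum (map f xs) ≤ sum (map g xs)
  sum-map-mono f≤g []       = z≤n
  sum-map-mono f≤g (x ∷ xs) = +-mono-≤ (f≤g x) (sum-map-mono f≤g xs)

  sum-map-*ʳ : ∀ (f : A → ℕ) c xs → sum (map (λ x → f x * c) xs) ≡ sum (map f xs) * c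
  sum-map-*ʳ f c []       = refl
  sum-map-*ʳ f c (x ∷ xs) = begin
    f x * c + sum (map (λ x → f x * c) xs) ≡⟨ cong (f x * c +_) (sum-map-*ʳ f c xs) ⟩
    f x * c + sum (map f xs) * c           ≡⟨ sym (*-distribʳ-+ c (f x) _) ⟩
    (f x + sum (map f xs)) * c             ∎
    where open ≡-Reasoning

  countIn-mono : ∀ {p q : A → Bool} → (∀ x → T (p x) → T (q x)) →
                 ∀ xs → countIn p xs ≤ countIn q xs
  countIn-mono {p} {q} p⇒q = sum-map-mono λ x → indicator-mono (p x) (q x) (p⇒q x)

  countIn-< : ∀ {p q : A → Bool} {y xs} → (∀ x → T (p x) → T (q x)) →
              y ∈ xs → T (q y) → ¬ T (p y) → suc (countIn p xs) ≤ countIn q xs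
  countIn-< {p} {q} p⇒q (here {xs = xs} refl) qy ¬py =
    +-mono-≤ (indicator-< (p _) (q _) ¬py qy) (countIn-mono p⇒q xs)
  countIn-< {p} {q} p⇒q (there {x} {xs} y∈xs) qy ¬py = begin
    suc (indicator (p x) + countIn p xs) ≡⟨ sym (+-suc (indicator (p x)) _) ⟩
    indicator (p x) + suc (countIn p xs) ≤⟨ +-mono-≤ (indicator-mono (p x) (q x) (p⇒q x)) (countIn-< p⇒q y∈xs qy ¬py) ⟩
    indicator (q x) + countIn q xs       ∎
    where open ≤-Reasoning

  countIn-∨ : ∀ (p q : A → Bool) xs → countIn (λ x → p x ∨ q x) xs ≤ countIn p xs + countIn q xs
  countIn-∨ p q []       = z≤n
  countIn-∨ p q (x ∷ xs) = begin
    indicator (p x ∨ q x) + countIn (λ x → p x ∨ q x) xs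
      ≤⟨ +-mono-≤ (indicator-∨ (p x) (q x)) (countIn-∨ p q xs) ⟩
    (indicator (p x) + indicator (q x)) + (countIn p xs + countIn q xs)
      ≡⟨ interchange +-commutativeSemigroup (indicator (p x)) (indicator (q x)) (countIn p xs) (countIn q xs) ⟩
    (indicator (p x) + countIn p xs) + (indicator (q x) + countIn q xs) ∎
    where open ≤-Reasoning

  countIn-none : ∀ {p : A → Bool} {xs} → All (λ x → ¬ T (p x)) xs → countIn p xs ≡ 0
  countIn-none All.[] = refl
  countIn-none {p} (All._∷_ {x} ¬px none) with p x
  ... | true  = ⊥-elim (¬px _)
  ... | false = countIn-none none

  countIn-∧ˡ : ∀ b (p : A → Bool) xs → countIn (λ x → b ∧ p x) xs ≤ indicator b * countIn p xs
  countIn-∧ˡ true  p xs = ≤-reflexive (sym (*-identityˡ _))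
  countIn-∧ˡ false p xs = ≤-reflexive (countIn-none (All.universal (λ _ ()) xs))

  countIn-≟ : (_≟_ : DecidableEquality A) (a : A) {xs : List A} → Unique xs →
              countIn (λ x → ⌊ x ≟ a ⌋) xs ≤ 1
  countIn-≟ _≟_ a []                          = z≤n
  countIn-≟ _≟_ a {x ∷ xs} (x∉xs ∷ unique) with x ≟ a
  ... | no  _    = countIn-≟ _≟_ a unique
  ... | yes refl = ≤-reflexive (cong suc (countIn-none (All.map (λ a≢y y≟a → a≢y (sym (toWitness y≟a))) x∉xs)))

module _ {A : Set} {S : A → Set} (S? : Decidable S) (_≽_ : A → A → Set)
         (≽-total : ∀ {x y} → S x → S y → x ≽ y ⊎ y ≽ x)
         (≽-trans : ∀ {x y z} → S x → S y → S z → x ≽ y → y ≽ z → x ≽ z) where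

  private
    ≽-refl : ∀ {x} → S x → x ≽ x
    ≽-refl sx = reduce (≽-total sx sx)

  least : ∀ xs → All (λ x → ¬ S x) xs ⊎ ∃[ d ] (S d × All (λ x → S x → x ≽ d) xs)
  least [] = inj₁ All.[]
  least (x ∷ xs) with S? x | least xs
  ... | no ¬sx | inj₁ none           = inj₁ (¬sx All.∷ none)
  ... | no ¬sx | inj₂ (d , sd , ≽d)  = inj₂ (d , sd , (λ sx → ⊥-elim (¬sx sx)) All.∷ ≽d)
  ... | yes sx | inj₁ none           = inj₂ (x , sx , ≽-refl All.∷ All.map (λ ¬s s → ⊥-elim (¬s s)) none)
  ... | yes sx | inj₂ (d , sd , ≽d) with ≽-total sx sd
  ...   | inj₁ x≽d = inj₂ (d , sd , (λ _ → x≽d) All.∷ ≽d)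
  ...   | inj₂ d≽x = inj₂ (x , sx , ≽-refl All.∷ All.map (λ y≽d sy → ≽-trans sy sd sx (y≽d sy) d≽x) ≽d)

module _ {A : Set} where

  remove-∈ : ∀ {x : A} {ys} → x ∈ ys →
           ∃[ zs ] (length ys ≡ suc (length zs) × (∀ {y} → y ∈ ys → y ≢ x → y ∈ zs))
  remove-∈ {ys = _ ∷ ys} (here refl) = ys , refl , λ where
    (here refl) y≢y → ⊥-elim (y≢y refl)
    (there y∈ys) _  → y∈ys
  remove-∈ {ys = z ∷ ys} (there x∈ys) with zs , len , ⊆zs ← remove-∈ x∈ys =
    z ∷ zs , cong suc len , λ where
      (here refl)  _   → here refl
      (there y∈ys) y≢x → there (⊆zs y∈ys y≢x)

  Unique∧⊆⇒length≤ : ∀ {xs ys : List A} → Unique xs → xs ⊆ ys → length xs ≤ length ys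
  Unique∧⊆⇒length≤ {[]}     _                xs⊆ys = z≤n
  Unique∧⊆⇒length≤ {x ∷ xs} (x∉xs ∷ unique) xs⊆ys
    with zs , len , ⊆zs ← remove-∈ (xs⊆ys (here refl)) =
    subst (suc (length xs) ≤_) (sym len)
      (s≤s (Unique∧⊆⇒length≤ unique λ y∈xs → ⊆zs (xs⊆ys (there y∈xs)) λ y≡x → All.lookup x∉xs y∈xs (sym y≡x)))

module _ {A B : Set} where

  length-concatMap-≤ : ∀ {f : A → List B} {g : A → ℕ} → (∀ x → length (f x) ≤ g x) →
                       ∀ xs → length (concatMap f xs) ≤ sum (map g xs)
  length-concatMap-≤ f≤g []       = z≤n
  length-concatMap-≤ {f} f≤g (x ∷ xs) = begin
    length (f x ++ concatMap f xs)          ≡⟨ length-++ (f x) ⟩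
    length (f x) + length (concatMap f xs)  ≤⟨ +-mono-≤ (f≤g x) (length-concatMap-≤ f≤g xs) ⟩
    _ ∎
    where open ≤-Reasoning

module _ {B : Set} where

  ∈-concatMap-allFin : ∀ {n} {f : Fin n → List B} {y} i → y ∈ f i → y ∈ concatMap f (allFin n)
  ∈-concatMap-allFin {f = f} i y∈fi = ∈-concatMap⁺ f (lose (∈-allFin i) y∈fi)

  length-singletonIf : ∀ b (y : B) → length (if b then [ y ] else []) ≡ indicator b
  length-singletonIf true  y = refl
  length-singletonIf false y = refl

  ∈-singletonIf : ∀ {b} (y : B) → T b → y ∈ (if b then [ y ] else [])
  ∈-singletonIf {true} y _ = here refl

orient : ∀ {n} → Fin n → Fin n → Fin n × Fin n
orient x y with toℕ x <? toℕ y
... | yes _ = x , y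
... | no  _ = y , x

orient-< : ∀ {n} {x y : Fin n} → toℕ x < toℕ y → orient x y ≡ (x , y)
orient-< {x = x} {y} x<y with toℕ x <? toℕ y
... | yes _   = refl
... | no  x≮y = ⊥-elim (x≮y x<y)

orient-> : ∀ {n} {x y : Fin n} → toℕ x < toℕ y → orient y x ≡ (x , y)
orient-> {x = x} {y} x<y with toℕ y <? toℕ x
... | yes y<x = ⊥-elim (<-asym x<y y<x)
... | no  _   = refl

m*m≤m^3 : ∀ m → m * m ≤ m ^ 3
m*m≤m^3 zero      = z≤n
m*m≤m^3 m@(suc _) = *-monoʳ-≤ m (m≤m*n m (m * 1))

module _ {n : ℕ} (P : Profile n) where
  open Profile P

  spref⁻ : ∀ {i x y} → T (spref P i x y) →
           T (acc i x) × T (acc i y) × T (wpref i x y) × ¬ T (wpref i y x)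
  spref⁻ {i} {x} {y} t with acc i x | acc i y | wpref i x y | wpref i y x
  ... | true | true | true | false = _ , _ , _ , λ ()

  spref-irrefl : ∀ {i x} → ¬ T (spref P i x x)
  spref-irrefl t with _ , _ , x≽x , x⋡x ← spref⁻ t = x⋡x x≽x

  spref⇒≢ : ∀ {i x y} → T (spref P i x y) → x ≢ y
  spref⇒≢ t refl = spref-irrefl t

  prefersTo : Fin n → Maybe (Fin n) → Fin n → Bool
  prefersTo u (just v) w = spref P u w v
  prefersTo u nothing  w = false

  count-prefersTo : ∀ u m → count (prefersTo u m) ≤ rankM P u m
  count-prefersTo u (just v) = ≤-refl
  count-prefersTo u nothing  =
    subst (_≤ rankM P u nothing) (sym (countIn-none (All.universal (λ _ ()) (allFin n)))) z≤n

module _ {n : ℕ} (P : Profile n) (γ : ℕ) where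
  open Profile P

  atLeastAsGood : Fin n → Fin n → Fin n → Bool
  atLeastAsGood w d x = acc w x ∧ not ⌊ x ≟ d ⌋ ∧ wpref w x d

  harmless? : Fin n → Fin n → Bool
  harmless? w d = count (atLeastAsGood w d) ≤ᵇ γ

  leavesFor : Fin n → Fin n → Fin n → Bool
  leavesFor u w d = spref P w u d ∧ harmless? w d

  leavesFor⇒spref : ∀ {u w d} → T (leavesFor u w d) → T (spref P w u d)
  leavesFor⇒spref t = proj₁ (Equivalence.to T-∧ t)

  leavesFor⇒acc : ∀ {u w d} → T (leavesFor u w d) → T (acc w d)
  leavesFor⇒acc t = proj₁ (proj₂ (spref⁻ P (leavesFor⇒spref t)))

  count-leavesFor≤ : ∀ u w → count (leavesFor u w) ≤ γ
  count-leavesFor≤ u w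
    with least (λ d → T? (leavesFor u w d)) (λ x y → T (wpref w x y))
               (λ sx sy → complete w _ _ (leavesFor⇒acc sx) (leavesFor⇒acc sy))
               (λ sx sy sz → transitive w _ _ _ (leavesFor⇒acc sx) (leavesFor⇒acc sy) (leavesFor⇒acc sz))
               (allFin n)
  ... | inj₁ none = subst (_≤ γ) (sym (countIn-none none)) z≤n
  ... | inj₂ (d₀ , leaves₀ , ≽d₀) = ≤-pred (begin
    suc (count (leavesFor u w))
      ≤⟨ countIn-< leaves⇒d₀∨atLeastD₀ (∈-allFin u) u-atLeastD₀ (spref-irrefl P ∘ leavesFor⇒spref) ⟩
    count (λ x → d₀? x ∨ atLeastD₀ x)
      ≤⟨ countIn-∨ d₀? atLeastD₀ (allFin n) ⟩
    count d₀? + count atLeastD₀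
      ≤⟨ +-mono-≤ (countIn-≟ _≟_ d₀ (allFin⁺ n)) (≤ᵇ⇒≤ _ γ harmless₀) ⟩
    suc γ ∎)
    where
    open ≤-Reasoning
    d₀? atLeastD₀ : Fin n → Bool
    d₀? x = ⌊ x ≟ d₀ ⌋
    atLeastD₀ = atLeastAsGood w d₀
    harmless₀ : T (harmless? w d₀)
    harmless₀ = proj₂ (Equivalence.to T-∧ leaves₀)
    leaves⇒d₀∨atLeastD₀ : ∀ x → T (leavesFor u w x) → T (d₀? x ∨ atLeastD₀ x)
    leaves⇒d₀∨atLeastD₀ x leaves with x ≟ d₀
    ... | yes _   = _
    ... | no  _   = T-∧⁺ (leavesFor⇒acc leaves) (T-∧⁺ _ (All.lookup ≽d₀ (∈-allFin x) leaves))
    u-atLeastD₀ : T (d₀? u ∨ atLeastD₀ u)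
    u-atLeastD₀ with acc-u , _ , u≽d₀ , _ ← spref⁻ P (leavesFor⇒spref leaves₀) =
      Equivalence.from T-∨ (inj₂ (T-∧⁺ acc-u (T-∧⁺ (fromWitnessFalse (spref⇒≢ P (leavesFor⇒spref leaves₀))) u≽d₀)))

module _ {n : ℕ} (P : Profile n) (γ : ℕ) (M : Matching P) where

  blocksAt : Fin n → Fin n → Fin n → Bool
  blocksAt u w d = prefersTo P u (partner M u) w ∧ leavesFor P γ u w d

  charge : Fin n → ℕ
  charge u = sum (map (λ w → count (blocksAt u w)) (allFin n))

  charge≤ : ∀ u → charge u ≤ rankM P u (partner M u) * γ
  charge≤ u = begin
    charge u                                               ≤⟨ sum-map-mono count-blocksAt≤ (allFin n) ⟩
    sum (map (λ w → indicator (prefers w) * γ) (allFin n)) ≡⟨ sum-map-*ʳ (indicator ∘ prefers) γ (allFin n) ⟩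
    count prefers * γ                                      ≤⟨ *-monoˡ-≤ γ (count-prefersTo P u (partner M u)) ⟩
    rankM P u (partner M u) * γ                            ∎
    where
    open ≤-Reasoning
    prefers : Fin n → Bool
    prefers = prefersTo P u (partner M u)
    count-blocksAt≤ : ∀ w → count (blocksAt u w) ≤ indicator (prefers w) * γ
    count-blocksAt≤ w = ≤-trans (countIn-∧ˡ (prefers w) (leavesFor P γ u w) (allFin n))
                                (*-monoʳ-≤ (indicator (prefers w)) (count-leavesFor≤ P γ u w))

  totalCharge≤ : egalitarianCost P M ≤ γ → sum (map charge (allFin n)) ≤ γ * γ
  totalCharge≤ cost≤γ = begin
    sum (map charge (allFin n))                              ≤⟨ sum-map-mono charge≤ (allFin n) ⟩
    sum (map (λ u → rankM P u (partner M u) * γ) (allFin n)) ≡⟨ sum-map-*ʳ (λ u → rankM P u (partner M u)) γ (allFin n) ⟩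
    egalitarianCost P M * γ                                  ≤⟨ *-monoˡ-≤ γ cost≤γ ⟩
    γ * γ                                                    ∎
    where open ≤-Reasoning

  blockedEdges : List (Fin n × Fin n)
  blockedEdges = concatMap (λ u → concatMap (λ w → concatMap (λ d →
    if blocksAt u w d then [ orient w d ] else []) (allFin n)) (allFin n)) (allFin n)

  length-blockedEdges : length blockedEdges ≤ sum (map charge (allFin n))
  length-blockedEdges =
    length-concatMap-≤ (λ u → length-concatMap-≤ (λ w → length-concatMap-≤ (λ d →
      ≤-reflexive (length-singletonIf (blocksAt u w d) (orient w d))) (allFin n)) (allFin n)) (allFin n)

  ∈-blockedEdges : ∀ {u w d} → T (blocksAt u w d) → orient w d ∈ blockedEdges
  ∈-blockedEdges {u} {w} {d} t =
    ∈-concatMap-allFin u (∈-concatMap-allFin w (∈-concatMap-allFin d (∈-singletonIf (orient w d) t)))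

  blockEachOtherAt⇒blocksAt : ∀ {u v w d} → partner M u ≡ just v →
    BlockEachOtherAt P u v w d → Harmless P γ w d → T (blocksAt u w d)
  blockEachOtherAt⇒blocksAt {u} {w = w} Mu≡v (_ , w≻v , u≻d) harmless =
    T-∧⁺ (subst (λ m → T (prefersTo P u m w)) (sym Mu≡v) w≻v) (T-∧⁺ u≻d (≤⇒≤ᵇ harmless))

  harmlesslyBlocked⇒blocksAt : ∀ {x y} → HarmlesslyBlockedByM P γ M x y →
    ∃[ u ] (T (blocksAt u x y) ⊎ T (blocksAt u y x))
  harmlesslyBlocked⇒blocksAt (a , b , Ma≡b , inj₁ (block , harmless)) =
    a , inj₁ (blockEachOtherAt⇒blocksAt Ma≡b block harmless)
  harmlesslyBlocked⇒blocksAt (a , b , Ma≡b , inj₂ (inj₁ (block , harmless))) =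
    a , inj₂ (blockEachOtherAt⇒blocksAt Ma≡b block harmless)
  harmlesslyBlocked⇒blocksAt (a , b , Ma≡b , inj₂ (inj₂ (inj₁ (block , harmless)))) =
    b , inj₁ (blockEachOtherAt⇒blocksAt (symmetric M a b Ma≡b) block harmless)
  harmlesslyBlocked⇒blocksAt (a , b , Ma≡b , inj₂ (inj₂ (inj₂ (block , harmless)))) =
    b , inj₂ (blockEachOtherAt⇒blocksAt (symmetric M a b Ma≡b) block harmless)

  harmlesslyBlocked⇒∈ : ∀ {x y} → toℕ x < toℕ y → HarmlesslyBlockedByM P γ M x y → (x , y) ∈ blockedEdges
  harmlesslyBlocked⇒∈ x<y blocked with harmlesslyBlocked⇒blocksAt blocked
  ... | _ , inj₁ t = subst (_∈ blockedEdges) (orient-< x<y) (∈-blockedEdges t)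
  ... | _ , inj₂ t = subst (_∈ blockedEdges) (orient-> x<y) (∈-blockedEdges t)

lemma11 : (n : ℕ) (P : Profile n) (γ : ℕ) (M : Matching P) →
          Stable P M → egalitarianCost P M ≤ γ →
          (L : List (Fin n × Fin n)) → Unique L →
          All (λ { (x , y) → toℕ x < toℕ y × InE₁ P γ x y × HarmlesslyBlockedByM P γ M x y }) L →
          length L ≤ γ ^ 3
lemma11 n P γ M _ cost≤γ L unique blocked = begin
  length L                              ≤⟨ Unique∧⊆⇒length≤ unique L⊆blockedEdges ⟩
  length (blockedEdges P γ M)           ≤⟨ length-blockedEdges P γ M ⟩
  sum (map (charge P γ M) (allFin n))   ≤⟨ totalCharge≤ P γ M cost≤γ ⟩
  γ * γ                                 ≤⟨ m*m≤m^3 γ ⟩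
  γ ^ 3                                 ∎
  where
  open ≤-Reasoning
  L⊆blockedEdges : L ⊆ blockedEdges P γ M
  L⊆blockedEdges {x , y} e∈L with x<y , _ , harmlesslyBlocked ← All.lookup blocked e∈L =
    harmlesslyBlocked⇒∈ P γ M x<y harmlesslyBlocked
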